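{- For $x \in \mathbb{C}$ and $n\in\mathbb{N}_0$, $$\sum_{k=1}^n k^4 H_k^{(3)}(x) = \frac{6x^5 + 15x^4 + 10x^3 - x - n + 10n^3 + 15n^4 + 6n^5}{30} H_n^{(3)}(x) - \frac{30x^2(x+1)^2 - 1}{30} H_n^{(2)}(x) + x(x+1)(2x+1)H_n(x) - \frac{(72x^2 + 72x - 18nx + 7 - 9n + 4n^2)n}{60}.$$
   Context: For $x\in\mathbb{C}$, $l,n\in\mathbb{N}_0$, $H_0^{(l)}(x)=0$ and $H_n^{(l)}(x)=\sum_{k=1}^n \frac{1}{(x+k)^l}$ for $n\ge 1$ (defined whenever $x$ is not one of $-1,\dots,-n$); $H_n(x)=H_n^{(1)}(x)$. -}

module Defs where

open import Level using (_⊔_) renaming (suc to lsuc)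
open import Data.Nat using (ℕ; zero; suc)
open import Relation.Nullary using (¬_)
open import Algebra.Bundles using (CommutativeRing)

ιᴿ : ∀ {c ℓ} (R : CommutativeRing c ℓ) → ℕ → CommutativeRing.Carrier R
ιᴿ R zero    = CommutativeRing.0# R
ιᴿ R (suc n) = CommutativeRing._+_ R (CommutativeRing.1# R) (ιᴿ R n)

-- A field of characteristic zero (ℂ is an instance).  The inverse is a
-- total function (value at 0 irrelevant), specified on nonzero elements.
record CharZeroField c ℓ : Set (lsuc (c ⊔ ℓ)) where
  field
    commRing : CommutativeRing c ℓ
  open CommutativeRing commRing public

  ι : ℕ → Carrier
  ι = ιᴿ commRing

  field
    _⁻¹      : Carrier → Carrier
    ⁻¹-cong  : ∀ {a b} → a ≈ b → a ⁻¹ ≈ b ⁻¹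
    inverseʳ : ∀ a → ¬ (a ≈ 0#) → a * a ⁻¹ ≈ 1#
    charZero : ∀ n → ¬ (ι (suc n) ≈ 0#)

  infixr 8 _^_
  _^_ : Carrier → ℕ → Carrier
  a ^ zero  = 1#
  a ^ suc m = a * a ^ m

  Σ₁ : ℕ → (ℕ → Carrier) → Carrier
  Σ₁ zero    f = 0#
  Σ₁ (suc n) f = Σ₁ n f + f (suc n)

  H : ℕ → ℕ → Carrier → Carrier
  H l n x = Σ₁ n (λ k → ((x + ι k) ^ l) ⁻¹)

module Submission where

-- With α = 1/30, β = 1/60 and polynomials A(N), B, C, P(N) in x, the
-- right-hand side is R(n) = A(n)α H⁽³⁾ₙ - Bα H⁽²⁾ₙ + C H⁽¹⁾ₙ - P(n)β.  As R(0) = 0,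
-- the theorem follows by telescoping from R(n+1) - R(n) = (n+1)⁴ H⁽³⁾ₙ₊₁.
-- Writing H⁽ˡ⁾ₙ₊₁ = H⁽ˡ⁾ₙ + vₗ with vₗ = 1/wˡ, w = x+n+1, the difference splits
-- into an H⁽³⁾ₙ-part, which is (n+1)⁴ H⁽³⁾ₙ since A(n+1) - A(n) = 30(n+1)⁴, and
-- a v-part, which after clearing the denominator 60w³ becomes the polynomial
-- identity 2A(n+1) - 2Bw + 60Cw² - (P(n+1)-P(n))w³ = 60(n+1)⁴.
--
-- Polynomial identities are proved by the standard library's ring solver,
-- instantiated with integer coefficients after extending the canonical map
-- ℕ → F to a ring morphism ℤ → F.

open import Defs
open import Data.Nat as ℕ using (ℕ; zero; suc; _≤_; _<_; s≤s; z≤n)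
open import Data.Nat.Properties using (m<n⇒m<1+n; n<1+n) renaming (+-suc to ℕ+-suc)
open import Data.Integer as ℤ using (ℤ; +_; -[1+_]; _⊖_; sign; ∣_∣; _◃_)
open import Data.Integer.Properties using ([1+m]⊖[1+n]≡m⊖n; ◃-inverse)
open import Data.Sign as Sign using (Sign)
open import Data.Maybe using (Maybe; just; nothing)
open import Relation.Nullary using (¬_; yes; no)
import Relation.Binary.PropositionalEquality as ≡
open import Algebra.Solver.Ring.AlmostCommutativeRing
  using (_-Raw-AlmostCommutative⟶_; fromCommutativeRing)

module _ {a ℓ} (F : CharZeroField a ℓ) where
  open CharZeroField F
  open import Algebra.Properties.Ring ring using (-0#≈0#; -‿involutive; -1*x≈-x)
  open import Algebra.Properties.AbelianGroup +-abelianGroup using (xyx⁻¹≈y; ⁻¹-∙-comm)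
  open import Algebra.Properties.Semiring.Mult semiring using (_×_; ×-homo-+; ×1-homo-*)
  open import Algebra.Properties.CommutativeSemigroup *-commutativeSemigroup
    using (interchange; xy∙z≈y∙xz)
  open import Relation.Binary.Reasoning.Setoid setoid

  ι≈×1 : ∀ n → ι n ≈ n × 1#
  ι≈×1 zero    = refl
  ι≈×1 (suc n) = +-congˡ (ι≈×1 n)

  ι-+ : ∀ m n → ι (m ℕ.+ n) ≈ ι m + ι n
  ι-+ m n = begin
    ι (m ℕ.+ n)       ≈⟨ ι≈×1 (m ℕ.+ n) ⟩
    (m ℕ.+ n) × 1#    ≈⟨ ×-homo-+ 1# m n ⟩
    m × 1# + n × 1#   ≈⟨ +-cong (ι≈×1 m) (ι≈×1 n) ⟨
    ι m + ι n         ∎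

  ι-* : ∀ m n → ι (m ℕ.* n) ≈ ι m * ι n
  ι-* m n = begin
    ι (m ℕ.* n)         ≈⟨ ι≈×1 (m ℕ.* n) ⟩
    (m ℕ.* n) × 1#      ≈⟨ ×1-homo-* m n ⟩
    m × 1# * (n × 1#)   ≈⟨ *-cong (ι≈×1 m) (ι≈×1 n) ⟨
    ι m * ι n           ∎

  ιℤ : ℤ → Carrier
  ιℤ (+ n)    = ι n
  ιℤ -[1+ n ] = - ι (suc n)

  1+-cancel : ∀ a b → (1# + a) - (1# + b) ≈ a - b
  1+-cancel a b = begin
    (1# + a) - (1# + b)      ≈⟨ +-congˡ (-‿cong (+-comm 1# b)) ⟩
    (1# + a) - (b + 1#)      ≈⟨ +-congˡ (⁻¹-∙-comm b 1#) ⟨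
    (1# + a) + (- b + - 1#)  ≈⟨ +-assoc (1# + a) (- b) (- 1#) ⟨
    (1# + a) - b - 1#        ≈⟨ +-congʳ (+-assoc 1# a (- b)) ⟩
    1# + (a - b) - 1#        ≈⟨ xyx⁻¹≈y 1# (a - b) ⟩
    a - b                    ∎

  ιℤ-⊖ : ∀ m n → ιℤ (m ⊖ n) ≈ ι m - ι n
  ιℤ-⊖ m       zero    = sym (trans (+-congˡ -0#≈0#) (+-identityʳ (ι m)))
  ιℤ-⊖ zero    (suc n) = sym (+-identityˡ _)
  ιℤ-⊖ (suc m) (suc n) = begin
    ιℤ (suc m ⊖ suc n)     ≡⟨ ≡.cong ιℤ ([1+m]⊖[1+n]≡m⊖n m n) ⟩
    ιℤ (m ⊖ n)             ≈⟨ ιℤ-⊖ m n ⟩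
    ι m - ι n              ≈⟨ 1+-cancel (ι m) (ι n) ⟨
    ι (suc m) - ι (suc n)  ∎

  ιℤ-+ : ∀ i j → ιℤ (i ℤ.+ j) ≈ ιℤ i + ιℤ j
  ιℤ-+ (+ m)    (+ n)    = ι-+ m n
  ιℤ-+ (+ m)    -[1+ n ] = ιℤ-⊖ m (suc n)
  ιℤ-+ -[1+ m ] (+ n)    = trans (ιℤ-⊖ n (suc m)) (+-comm _ _)
  ιℤ-+ -[1+ m ] -[1+ n ] = begin
    - ι (suc (suc (m ℕ.+ n)))  ≡⟨ ≡.cong (λ k → - ι (suc k)) (≡.sym (ℕ+-suc m n)) ⟩
    - ι (suc m ℕ.+ suc n)      ≈⟨ -‿cong (ι-+ (suc m) (suc n)) ⟩
    - (ι (suc m) + ι (suc n))  ≈⟨ ⁻¹-∙-comm (ι (suc m)) (ι (suc n)) ⟨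
    - ι (suc m) - ι (suc n)    ∎

  ιℤ-neg : ∀ i → ιℤ (ℤ.- i) ≈ - ιℤ i
  ιℤ-neg (+ zero)  = sym -0#≈0#
  ιℤ-neg (+ suc n) = refl
  ιℤ-neg -[1+ n ]  = sym (-‿involutive _)

  σ : Sign → Carrier
  σ Sign.+ = 1#
  σ Sign.- = - 1#

  σ-* : ∀ s t → σ (s Sign.* t) ≈ σ s * σ t
  σ-* Sign.+ t      = sym (*-identityˡ _)
  σ-* Sign.- Sign.+ = sym (*-identityʳ _)
  σ-* Sign.- Sign.- = sym (trans (-1*x≈-x _) (-‿involutive _))

  ιℤ-◃ : ∀ s n → ιℤ (s ◃ n) ≈ σ s * ι n
  ιℤ-◃ s      zero    = sym (zeroʳ _)
  ιℤ-◃ Sign.+ (suc n) = sym (*-identityˡ _)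
  ιℤ-◃ Sign.- (suc n) = sym (-1*x≈-x _)

  ιℤ-signAbs : ∀ i → ιℤ i ≈ σ (sign i) * ι ∣ i ∣
  ιℤ-signAbs i = trans (reflexive (≡.cong ιℤ (≡.sym (◃-inverse i)))) (ιℤ-◃ (sign i) ∣ i ∣)

  ιℤ-* : ∀ i j → ιℤ (i ℤ.* j) ≈ ιℤ i * ιℤ j
  ιℤ-* i j = begin
    ιℤ (sign i Sign.* sign j ◃ ∣ i ∣ ℕ.* ∣ j ∣)        ≈⟨ ιℤ-◃ (sign i Sign.* sign j) (∣ i ∣ ℕ.* ∣ j ∣) ⟩
    σ (sign i Sign.* sign j) * ι (∣ i ∣ ℕ.* ∣ j ∣)     ≈⟨ *-cong (σ-* (sign i) (sign j)) (ι-* ∣ i ∣ ∣ j ∣) ⟩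
    σ (sign i) * σ (sign j) * (ι ∣ i ∣ * ι ∣ j ∣)      ≈⟨ interchange (σ (sign i)) (σ (sign j)) (ι ∣ i ∣) (ι ∣ j ∣) ⟩
    σ (sign i) * ι ∣ i ∣ * (σ (sign j) * ι ∣ j ∣)      ≈⟨ *-cong (ιℤ-signAbs i) (ιℤ-signAbs j) ⟨
    ιℤ i * ιℤ j                                        ∎

  -- The coefficient interpretation agrees with ιℤ but sends 1 to 1# on the
  -- nose, so that solver expressions evaluate to exactly the terms written
  -- in the statements below (for instance 1# + N for the successor).
  coeff : ℤ → Carrier
  coeff (+ 1) = 1#
  coeff i     = ιℤ i

  coeff≈ιℤ : ∀ i → coeff i ≈ ιℤ i
  coeff≈ιℤ (+ 0)           = refl
  coeff≈ιℤ (+ 1)           = sym (+-identityʳ 1#)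
  coeff≈ιℤ (+ suc (suc n)) = refl
  coeff≈ιℤ -[1+ n ]        = refl

  coeff-morphism : ℤ.+-*-rawRing -Raw-AlmostCommutative⟶ fromCommutativeRing commRing
  coeff-morphism = record
    { ⟦_⟧    = coeff
    ; +-homo = λ i j → via (ℤ._+_ i j) (ιℤ-+ i j) (+-cong (coeff≈ιℤ i) (coeff≈ιℤ j))
    ; *-homo = λ i j → via (ℤ._*_ i j) (ιℤ-* i j) (*-cong (coeff≈ιℤ i) (coeff≈ιℤ j))
    ; -‿homo = λ i → via (ℤ.- i) (ιℤ-neg i) (-‿cong (coeff≈ιℤ i))
    ; 0-homo = refl
    ; 1-homo = refl
    }
    where
    via : ∀ k {y z} → ιℤ k ≈ y → z ≈ y → coeff k ≈ z
    via k k≈y z≈y = trans (coeff≈ιℤ k) (trans k≈y (sym z≈y))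

  coeff≟ : ∀ i j → Maybe (coeff i ≈ coeff j)
  coeff≟ i j with i ℤ.≟ j
  ... | yes ≡.refl = just refl
  ... | no _       = nothing

  open import Algebra.Solver.Ring ℤ.+-*-rawRing (fromCommutativeRing commRing) coeff-morphism coeff≟
    using (Polynomial; solve; _:=_; con; _:+_; _:-_; _:*_; _:^_)

  A : Carrier → Carrier → Carrier
  A x N = ι 6 * x ^ 5 + ι 15 * x ^ 4 + ι 10 * x ^ 3 - x - N + ι 10 * N ^ 3 + ι 15 * N ^ 4 + ι 6 * N ^ 5

  B : Carrier → Carrier
  B x = ι 30 * x ^ 2 * (x + 1#) ^ 2 - 1#

  C : Carrier → Carrier
  C x = x * (x + 1#) * (ι 2 * x + 1#)

  P : Carrier → Carrier → Carrier
  P x N = (ι 72 * x ^ 2 + ι 72 * x - ι 18 * N * x + ι 7 - ι 9 * N + ι 4 * N ^ 2) * N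

  Aᵖ Pᵖ : ∀ {k} → Polynomial k → Polynomial k → Polynomial k
  Aᵖ x N = con (+ 6) :* x :^ 5 :+ con (+ 15) :* x :^ 4 :+ con (+ 10) :* x :^ 3 :- x :- N
             :+ con (+ 10) :* N :^ 3 :+ con (+ 15) :* N :^ 4 :+ con (+ 6) :* N :^ 5
  Pᵖ x N = (con (+ 72) :* x :^ 2 :+ con (+ 72) :* x :- con (+ 18) :* N :* x :+ con (+ 7)
              :- con (+ 9) :* N :+ con (+ 4) :* N :^ 2) :* N

  Bᵖ Cᵖ : ∀ {k} → Polynomial k → Polynomial k
  Bᵖ x = con (+ 30) :* x :^ 2 :* (x :+ con (+ 1)) :^ 2 :- con (+ 1)
  Cᵖ x = x :* (x :+ con (+ 1)) :* (con (+ 2) :* x :+ con (+ 1))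

  A-increment : ∀ x N → A x (1# + N) - A x N ≈ ι 30 * (1# + N) ^ 4
  A-increment = solve 2 (λ x N →
    Aᵖ x (con (+ 1) :+ N) :- Aᵖ x N := con (+ 30) :* (con (+ 1) :+ N) :^ 4) refl

  -- The identity behind the terms in 1/w, 1/w², 1/w³ (w = x + N + 1),
  -- after multiplication by 60w³.
  v-part-numerator : ∀ x N →
    ι 2 * A x (1# + N) - ι 2 * B x * (x + (1# + N)) + ι 60 * C x * (x + (1# + N)) ^ 2
      - (P x (1# + N) - P x N) * (x + (1# + N)) ^ 3
    ≈ ι 60 * (1# + N) ^ 4
  v-part-numerator = solve 2 (λ x N →
    con (+ 2) :* Aᵖ x (con (+ 1) :+ N) :- con (+ 2) :* Bᵖ x :* (x :+ (con (+ 1) :+ N))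
      :+ con (+ 60) :* Cᵖ x :* (x :+ (con (+ 1) :+ N)) :^ 2
      :- (Pᵖ x (con (+ 1) :+ N) :- Pᵖ x N) :* (x :+ (con (+ 1) :+ N)) :^ 3
    := con (+ 60) :* (con (+ 1) :+ N) :^ 4) refl

  1≉0 : ¬ (1# ≈ 0#)
  1≉0 1≈0 = charZero 0 (trans (+-identityʳ 1#) 1≈0)

  nonzero-factor : ∀ {a b} → ¬ (a ≈ 0#) → a * b ≈ 0# → b ≈ 0#
  nonzero-factor {a} {b} a≉0 ab≈0 = begin
    b                ≈⟨ *-identityˡ b ⟨
    1# * b           ≈⟨ *-congʳ (trans (*-comm (a ⁻¹) a) (inverseʳ a a≉0)) ⟨
    a ⁻¹ * a * b     ≈⟨ xy∙z≈y∙xz (a ⁻¹) a b ⟩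
    a * (a ⁻¹ * b)   ≈⟨ *-congˡ (*-comm (a ⁻¹) b) ⟩
    a * (b * a ⁻¹)   ≈⟨ *-assoc a b (a ⁻¹) ⟨
    a * b * a ⁻¹     ≈⟨ *-congʳ ab≈0 ⟩
    0# * a ⁻¹        ≈⟨ zeroˡ (a ⁻¹) ⟩
    0#               ∎

  ^-nonzero : ∀ {a} → ¬ (a ≈ 0#) → ∀ l → ¬ (a ^ l ≈ 0#)
  ^-nonzero a≉0 zero    = 1≉0
  ^-nonzero a≉0 (suc l) = λ aˡ⁺¹≈0 → ^-nonzero a≉0 l (nonzero-factor a≉0 aˡ⁺¹≈0)

  cancel-unit : ∀ {a b y z} → a * b ≈ 1# → a * y ≈ a * z → y ≈ z
  cancel-unit {a} {b} {y} {z} ab≈1 ay≈az = begin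
    y              ≈⟨ *-identityˡ y ⟨
    1# * y         ≈⟨ *-congʳ (trans (*-comm b a) ab≈1) ⟨
    b * a * y      ≈⟨ *-assoc b a y ⟩
    b * (a * y)    ≈⟨ *-congˡ ay≈az ⟩
    b * (a * z)    ≈⟨ *-assoc b a z ⟨
    b * a * z      ≈⟨ *-congʳ (trans (*-comm b a) ab≈1) ⟩
    1# * z         ≈⟨ *-identityˡ z ⟩
    z              ∎

  drop-unit : ∀ {t e} → e ≈ 1# → t * e ≈ t
  drop-unit {t} e≈1 = trans (*-congˡ e≈1) (*-identityʳ t)

  -- Passing from n to n+1 replaces a₀, p₀ by a₁, p₁ and hₗ by hₗ + vₗ;
  -- the increment splits into an h₃-part and a v-part.
  regroup : ∀ a₀ a₁ b c p₀ p₁ h₁ h₂ h₃ v₁ v₂ v₃ α β →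
    a₁ * α * (h₃ + v₃) - b * α * (h₂ + v₂) + c * (h₁ + v₁) - p₁ * β
    ≈ (a₀ * α * h₃ - b * α * h₂ + c * h₁ - p₀ * β) + (a₁ - a₀) * α * h₃
        + (a₁ * α * v₃ - b * α * v₂ + c * v₁ - (p₁ - p₀) * β)
  regroup = solve 14 (λ a₀ a₁ b c p₀ p₁ h₁ h₂ h₃ v₁ v₂ v₃ α β →
    a₁ :* α :* (h₃ :+ v₃) :- b :* α :* (h₂ :+ v₂) :+ c :* (h₁ :+ v₁) :- p₁ :* β
    := (a₀ :* α :* h₃ :- b :* α :* h₂ :+ c :* h₁ :- p₀ :* β) :+ (a₁ :- a₀) :* α :* h₃
        :+ (a₁ :* α :* v₃ :- b :* α :* v₂ :+ c :* v₁ :- (p₁ :- p₀) :* β)) refl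

  -- Multiplying the v-part by 60w³ exposes the products 30α, 60β, wˡvₗ.
  clear-denominators : ∀ a₁ b c d w α β v₁ v₂ v₃ →
    ι 60 * w ^ 3 * (a₁ * α * v₃ - b * α * v₂ + c * v₁ - d * β)
    ≈ ι 2 * a₁ * (ι 30 * α) * (w ^ 3 * v₃) - ι 2 * b * w * (ι 30 * α) * (w ^ 2 * v₂)
        + ι 60 * c * w ^ 2 * (w ^ 1 * v₁) - d * w ^ 3 * (ι 60 * β)
  clear-denominators = solve 10 (λ a₁ b c d w α β v₁ v₂ v₃ →
    con (+ 60) :* w :^ 3 :* (a₁ :* α :* v₃ :- b :* α :* v₂ :+ c :* v₁ :- d :* β)
    := con (+ 2) :* a₁ :* (con (+ 30) :* α) :* (w :^ 3 :* v₃)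
         :- con (+ 2) :* b :* w :* (con (+ 30) :* α) :* (w :^ 2 :* v₂)
         :+ con (+ 60) :* c :* w :^ 2 :* (w :^ 1 :* v₁) :- d :* w :^ 3 :* (con (+ 60) :* β)) refl

  v-part : ∀ {a₁ b c d w m α β v₁ v₂ v₃} →
    ι 2 * a₁ - ι 2 * b * w + ι 60 * c * w ^ 2 - d * w ^ 3 ≈ ι 60 * m ^ 4 →
    ι 30 * α ≈ 1# → ι 60 * β ≈ 1# →
    w ^ 1 * v₁ ≈ 1# → w ^ 2 * v₂ ≈ 1# → w ^ 3 * v₃ ≈ 1# →
    a₁ * α * v₃ - b * α * v₂ + c * v₁ - d * β ≈ m ^ 4 * v₃
  v-part {a₁} {b} {c} {d} {w} {m} {α} {β} {v₁} {v₂} {v₃} numerator 30α≈1 60β≈1 e₁ e₂ e₃ =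
    cancel-unit unit (begin
      ι 60 * w ^ 3 * (a₁ * α * v₃ - b * α * v₂ + c * v₁ - d * β)
        ≈⟨ clear-denominators a₁ b c d w α β v₁ v₂ v₃ ⟩
      ι 2 * a₁ * (ι 30 * α) * (w ^ 3 * v₃) - ι 2 * b * w * (ι 30 * α) * (w ^ 2 * v₂)
        + ι 60 * c * w ^ 2 * (w ^ 1 * v₁) - d * w ^ 3 * (ι 60 * β)
        ≈⟨ +-cong (+-cong (+-cong (drop-units 30α≈1 e₃) (-‿cong (drop-units 30α≈1 e₂)))
                          (drop-unit e₁))
                  (-‿cong (drop-unit 60β≈1)) ⟩
      ι 2 * a₁ - ι 2 * b * w + ι 60 * c * w ^ 2 - d * w ^ 3
        ≈⟨ numerator ⟩
      ι 60 * m ^ 4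
        ≈⟨ drop-unit e₃ ⟨
      ι 60 * m ^ 4 * (w ^ 3 * v₃)
        ≈⟨ interchange (ι 60) (m ^ 4) (w ^ 3) v₃ ⟩
      ι 60 * w ^ 3 * (m ^ 4 * v₃) ∎)
    where
    drop-units : ∀ {t e f} → e ≈ 1# → f ≈ 1# → t * e * f ≈ t
    drop-units e≈1 f≈1 = trans (drop-unit f≈1) (drop-unit e≈1)

    unit : ι 60 * w ^ 3 * (β * v₃) ≈ 1#
    unit = trans (interchange (ι 60) (w ^ 3) β v₃)
                 (trans (*-cong 60β≈1 e₃) (*-identityʳ 1#))

  closedForm : Carrier → ℕ → Carrier
  closedForm x n = A x (ι n) * ι 30 ⁻¹ * H 3 n x - B x * ι 30 ⁻¹ * H 2 n x
                     + C x * H 1 n x - P x (ι n) * ι 60 ⁻¹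

  closedForm-zero : ∀ x → closedForm x 0 ≈ 0#
  closedForm-zero x = vanishes x (ι 30 ⁻¹) (ι 60 ⁻¹)
    where
    vanishes : ∀ x α β →
      A x 0# * α * 0# - B x * α * 0# + C x * 0# - P x 0# * β ≈ 0#
    vanishes = solve 3 (λ x α β →
      Aᵖ x (con (+ 0)) :* α :* con (+ 0) :- Bᵖ x :* α :* con (+ 0) :+ Cᵖ x :* con (+ 0)
        :- Pᵖ x (con (+ 0)) :* β
      := con (+ 0)) refl

  closedForm-step : ∀ x n → ¬ (x + ι (suc n) ≈ 0#) →
    closedForm x (suc n) ≈ closedForm x n + ι (suc n) ^ 4 * H 3 (suc n) x
  closedForm-step x n w≉0 = begin
    closedForm x (suc n)
      ≈⟨ regroup a₀ a₁ b c p₀ p₁ h₁ h₂ h₃ v₁ v₂ v₃ α β ⟩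
    closedForm x n + (a₁ - a₀) * α * h₃ + (a₁ * α * v₃ - b * α * v₂ + c * v₁ - (p₁ - p₀) * β)
      ≈⟨ +-cong (+-congˡ h₃-part)
                (v-part (v-part-numerator x N) 30α≈1 60β≈1 (unit 1) (unit 2) (unit 3)) ⟩
    closedForm x n + m ^ 4 * h₃ + m ^ 4 * v₃
      ≈⟨ +-assoc (closedForm x n) (m ^ 4 * h₃) (m ^ 4 * v₃) ⟩
    closedForm x n + (m ^ 4 * h₃ + m ^ 4 * v₃)
      ≈⟨ +-congˡ (distribˡ (m ^ 4) h₃ v₃) ⟨
    closedForm x n + m ^ 4 * (h₃ + v₃) ∎
    where
    N m w α β a₀ a₁ b c p₀ p₁ h₁ h₂ h₃ v₁ v₂ v₃ : Carrier
    N = ι n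
    m = ι (suc n)
    w = x + m
    α = ι 30 ⁻¹
    β = ι 60 ⁻¹
    a₀ = A x N
    a₁ = A x m
    b = B x
    c = C x
    p₀ = P x N
    p₁ = P x m
    h₁ = H 1 n x
    h₂ = H 2 n x
    h₃ = H 3 n x
    v₁ = (w ^ 1) ⁻¹
    v₂ = (w ^ 2) ⁻¹
    v₃ = (w ^ 3) ⁻¹

    30α≈1 : ι 30 * α ≈ 1#
    30α≈1 = inverseʳ (ι 30) (charZero 29)

    60β≈1 : ι 60 * β ≈ 1#
    60β≈1 = inverseʳ (ι 60) (charZero 59)

    unit : ∀ l → w ^ l * (w ^ l) ⁻¹ ≈ 1#
    unit l = inverseʳ (w ^ l) (^-nonzero w≉0 l)

    h₃-part : (a₁ - a₀) * α * h₃ ≈ m ^ 4 * h₃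
    h₃-part = *-congʳ (begin
      (a₁ - a₀) * α       ≈⟨ *-congʳ (A-increment x N) ⟩
      ι 30 * m ^ 4 * α    ≈⟨ xy∙z≈y∙xz (ι 30) (m ^ 4) α ⟩
      m ^ 4 * (ι 30 * α)  ≈⟨ drop-unit 30α≈1 ⟩
      m ^ 4               ∎)

  telescope : ∀ (f R : ℕ → Carrier) n → R 0 ≈ 0# →
    (∀ k → k < n → R (suc k) ≈ R k + f (suc k)) → Σ₁ n f ≈ R n
  telescope f R zero    R₀≈0 increment = sym R₀≈0
  telescope f R (suc n) R₀≈0 increment = begin
    Σ₁ n f + f (suc n)  ≈⟨ +-congʳ (telescope f R n R₀≈0 (λ k k<n → increment k (m<n⇒m<1+n k<n))) ⟩
    R n + f (suc n)     ≈⟨ increment n (n<1+n n) ⟨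
    R (suc n)           ∎

proposition25 : ∀ {c ℓ} (F : CharZeroField c ℓ) → let open CharZeroField F in
    (x : Carrier) (n : ℕ) →
    (∀ k → 1 ≤ k → k ≤ n → ¬ (x + ι k ≈ 0#)) →
    Σ₁ n (λ k → ι k ^ 4 * H 3 k x)
      ≈ ((ι 6 * x ^ 5 + ι 15 * x ^ 4 + ι 10 * x ^ 3 - x - ι n + ι 10 * ι n ^ 3 + ι 15 * ι n ^ 4 + ι 6 * ι n ^ 5) * ι 30 ⁻¹ * H 3 n x
        - (ι 30 * x ^ 2 * (x + 1#) ^ 2 - 1#) * ι 30 ⁻¹ * H 2 n x
        + x * (x + 1#) * (ι 2 * x + 1#) * H 1 n x
        - (ι 72 * x ^ 2 + ι 72 * x - ι 18 * ι n * x + ι 7 - ι 9 * ι n + ι 4 * ι n ^ 2) * ι n * ι 60 ⁻¹)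
proposition25 F x n x+k≉0 =
  telescope F (λ k → ι k ^ 4 * H 3 k x) (closedForm F x) n (closedForm-zero F x)
    (λ k k<n → closedForm-step F x k (x+k≉0 (suc k) (s≤s z≤n) k<n))
  where open CharZeroField F
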